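{- Let $G$ be a graph that is not $(1,1,2,2)$-colorable and such that $S(G)$ is $(1,2,3,4,5)$-colorable. Then in every $5$-packing coloring of $S(G)$ at least one of the subdivision vertices of $S(G)$ receives a color larger than $1$.
   Context: For a positive integer $i$, an $i$-packing in a graph $H$ is a set of vertices any two distinct of which are at distance greater than $i$ in $H$. For a non-decreasing sequence $(s_1,\ldots,s_k)$ of positive integers, $H$ is $(s_1,\ldots,s_k)$-colorable if $V(H)$ can be partitioned into sets $\Pi_1,\ldots,\Pi_k$ with $\Pi_j$ an $s_j$-packing. A $5$-packing coloring of $H$ is a map $c:V(H)\to[5]$ such that $c^{ -1}(i)$ is an $i$-packing for each $i\in[5]$. The subdivision $S(G)$ is obtained from $G$ by inserting one new vertex $v_e$ (a subdivision vertex) on each edge $e$ of $G$, so $V(S(G))=V(G)\cup\{v_e: e\in E(G)\}$. -}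

module Defs where

open import Data.Nat using (ℕ; zero; suc; _≤_; _<_)
open import Data.Fin using (Fin)
import Data.Fin
open import Data.Fin.Properties using ()
open import Data.Bool using (Bool; true; false)
open import Data.Sum using (_⊎_; inj₁; inj₂)
open import Data.Product using (Σ; ∃; _×_; _,_)
open import Data.Vec using (Vec; lookup; _∷_; [])
open import Relation.Binary.PropositionalEquality using (_≡_; _≢_)
open import Relation.Nullary using (¬_)

record Graph : Set₁ where
  field
    V : Set
    E : V → V → Set
open Graph public

data Walk (H : Graph) : V H → V H → ℕ → Set where
  here : ∀ {x} → Walk H x x zero
  step : ∀ {x y z k} → E H x y → Walk H y z k → Walk H x z (suc k)

DistLe : (H : Graph) → V H → V H → ℕ → Set
DistLe H x y i = ∃ λ k → k ≤ i × Walk H x y k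

IsPacking : (H : Graph) → ℕ → (V H → Set) → Set
IsPacking H i P = ∀ x y → P x → P y → x ≢ y → ¬ DistLe H x y i

IsSColoring : (H : Graph) {k : ℕ} → Vec ℕ k → (V H → Fin k) → Set
IsSColoring H s c = ∀ j → IsPacking H (lookup s j) (λ v → c v ≡ j)

SColorable : (H : Graph) {k : ℕ} → Vec ℕ k → Set
SColorable H s = Σ (V H → Fin _) (IsSColoring H s)

record SimpleGraph (n : ℕ) : Set where
  field
    adj    : Fin n → Fin n → Bool
    sym    : ∀ u v → adj u v ≡ adj v u
    irrefl : ∀ u → adj u u ≡ false
open SimpleGraph public

toGraph : ∀ {n} → SimpleGraph n → Graph
toGraph {n} G = record { V = Fin n ; E = λ u v → adj G u v ≡ true }

-- Edges of G: each edge {u,v} is represented once as (u , v) with u < v.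
EdgeOf : ∀ {n} → SimpleGraph n → Set
EdgeOf {n} G = Σ (Fin n) λ u → Σ (Fin n) λ v → (Data.Fin._<_ u v) × adj G u v ≡ true

endpoint : ∀ {n} {G : SimpleGraph n} → Fin n → EdgeOf G → Set
endpoint x (u , v , _ , _) = (x ≡ u) ⊎ (x ≡ v)

data SubAdj {n} (G : SimpleGraph n) : Fin n ⊎ EdgeOf G → Fin n ⊎ EdgeOf G → Set where
  ve : ∀ {x e} → endpoint {G = G} x e → SubAdj G (inj₁ x) (inj₂ e)
  ev : ∀ {x e} → endpoint {G = G} x e → SubAdj G (inj₂ e) (inj₁ x)

S : ∀ {n} → SimpleGraph n → Graph
S {n} G = record { V = Fin n ⊎ EdgeOf G ; E = SubAdj G }

s1122 : Vec ℕ 4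
s1122 = 1 ∷ 1 ∷ 2 ∷ 2 ∷ []

s12345 : Vec ℕ 5
s12345 = 1 ∷ 2 ∷ 3 ∷ 4 ∷ 5 ∷ []

-- A 5-packing coloring: c : V(H) → Fin 5, where Fin index j stands for color j+1,
-- and c⁻¹(j+1) is a (j+1)-packing.
Is5PackingColoring : (H : Graph) → (V H → Fin 5) → Set
Is5PackingColoring H c = IsSColoring H s12345 c

-- If every subdivision vertex has color 1, then the colors of the original vertices,
-- with colors 1 and 2 merged, form a (1,1,2,2)-coloring of G: distances double when
-- passing from G to S(G), so colors 3, 4, 5 become 1-, 2-, 2-packings of G; two
-- neighbours x, y of G cannot both get a color in {1,2}, since a vertex colored 1 is
-- adjacent to the subdivision vertex of xy, and two vertices colored 2 are at distance 2.
-- Finiteness of E(G) turns "not all subdivision colors are 1" into an explicit edge.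
module Submission where

open import Defs
open import Data.Nat using (ℕ; zero; suc; _≤_; z≤n; s≤s)
open import Data.Nat.Properties using (≤-trans; ≤-refl; n≤1+n)
open import Data.Fin using (Fin; zero; suc; _≟_)
import Data.Fin as Fin
open import Data.Fin.Properties using (any?; <-cmp; _<?_; <-irrelevant)
open import Data.Bool using (true)
import Data.Bool as Bool
open import Data.Sum using (_⊎_; inj₁; inj₂)
open import Data.Product using (∃; Σ; _×_; _,_)
open import Data.Vec using (lookup)
open import Data.Empty using (⊥-elim)
open import Relation.Binary.PropositionalEquality using (_≡_; _≢_; refl; trans; subst)
import Relation.Binary.PropositionalEquality as ≡
open import Relation.Binary.Definitions using (tri<; tri≈; tri>)
open import Relation.Nullary using (¬_; Dec; yes; no)
open import Relation.Nullary.Decidable using (¬?; map′; decidable-stable)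
open import Axiom.UniquenessOfIdentityProofs using (module Decidable⇒UIP)

double : ℕ → ℕ
double zero    = zero
double (suc k) = suc (suc (double k))

double-mono-≤ : ∀ {k t} → k ≤ t → double k ≤ double t
double-mono-≤ z≤n     = z≤n
double-mono-≤ (s≤s p) = s≤s (s≤s (double-mono-≤ p))

distLe-1⇒adjacent : ∀ (H : Graph) {x y} → DistLe H x y 1 → x ≢ y → E H x y
distLe-1⇒adjacent H (zero  , _      , here)        x≢y = ⊥-elim (x≢y refl)
distLe-1⇒adjacent H (suc _ , _      , step a here) _   = a
distLe-1⇒adjacent H (suc _ , s≤s () , step _ (step _ _))

distLe-mono : ∀ {H : Graph} {x y i j} → i ≤ j → DistLe H x y i → DistLe H x y j
distLe-mono i≤j (k , k≤i , w) = k , ≤-trans k≤i i≤j , w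

module _ {n : ℕ} (G : SimpleGraph n) where

  adjacent⇒edge : ∀ {u v} → adj G u v ≡ true →
    Σ (EdgeOf G) λ e → endpoint {G = G} u e × endpoint {G = G} v e
  adjacent⇒edge {u} {v} a with <-cmp u v
  ... | tri< u<v _ _ = (u , v , u<v , a) , inj₁ refl , inj₂ refl
  ... | tri≈ _ refl _ with () ← trans (≡.sym (irrefl G u)) a
  ... | tri> _ _ v<u = (v , u , v<u , trans (≡.sym (SimpleGraph.sym G u v)) a) , inj₂ refl , inj₁ refl

  lift-walk : ∀ {x y k} → Walk (toGraph G) x y k → Walk (S G) (inj₁ x) (inj₁ y) (double k)
  lift-walk here       = here
  lift-walk (step a w) with adjacent⇒edge a
  ... | e , x∈e , y∈e = step (ve {e = e} x∈e) (step (ev y∈e) (lift-walk w))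

  lift-distLe : ∀ {x y i} → DistLe (toGraph G) x y i → DistLe (S G) (inj₁ x) (inj₁ y) (double i)
  lift-distLe (k , k≤i , w) = double k , double-mono-≤ k≤i , lift-walk w

  packing-restrict : ∀ {i r} {P : V (S G) → Set} → double i ≤ r → IsPacking (S G) r P →
    IsPacking (toGraph G) i (λ x → P (inj₁ x))
  packing-restrict 2i≤r pack x y Px Py x≢y d =
    pack (inj₁ x) (inj₁ y) Px Py (λ { refl → x≢y refl }) (distLe-mono 2i≤r (lift-distLe d))

  EdgeOf-proof-irrelevant : ∀ {u v} {u<v u<v′ : u Fin.< v} {a a′ : adj G u v ≡ true} →
    _≡_ {A = EdgeOf G} (u , v , u<v , a) (u , v , u<v′ , a′)
  EdgeOf-proof-irrelevant {u<v = u<v} {u<v′} {a} {a′}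
    rewrite <-irrelevant u<v u<v′ | Decidable⇒UIP.≡-irrelevant Bool._≟_ a a′ = refl

  any?-EdgeOf : {P : EdgeOf G → Set} → (∀ e → Dec (P e)) → Dec (∃ P)
  any?-EdgeOf {P} P? =
    map′ (λ (u , v , u<v , a , p) → (u , v , u<v , a) , p)
         (λ ((u , v , u<v , a) , p) → u , v , u<v , a , p)
         (any? λ u → any? λ v → P-at? u v)
    where
    P-at? : ∀ u v → Dec (Σ (u Fin.< v) λ u<v → Σ (adj G u v ≡ true) λ a → P (u , v , u<v , a))
    P-at? u v with u <? v
    ... | no u≮v = no λ (u<v , _) → u≮v u<v
    ... | yes u<v with adj G u v Bool.≟ true
    ...   | no ¬a = no λ (_ , a , _) → ¬a a
    ...   | yes a with P? (u , v , u<v , a)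
    ...     | yes p = yes (u<v , a , p)
    ...     | no ¬p = no λ (_ , _ , p) → ¬p (subst P EdgeOf-proof-irrelevant p)

merge-1-2 : Fin 5 → Fin 4
merge-1-2 zero    = zero
merge-1-2 (suc i) = i

merge-1-2≡zero : ∀ {i} → merge-1-2 i ≡ zero → i ≡ zero ⊎ i ≡ suc zero
merge-1-2≡zero {zero}     _    = inj₁ refl
merge-1-2≡zero {suc zero} refl = inj₂ refl

merge-1-2≡suc : ∀ {i j} → merge-1-2 i ≡ suc j → i ≡ suc (suc j)
merge-1-2≡suc {suc _} refl = refl

radius-doubles : ∀ (j : Fin 3) → double (lookup s1122 (suc j)) ≤ lookup s12345 (suc (suc j))
radius-doubles zero             = n≤1+n 2
radius-doubles (suc zero)       = ≤-refl
radius-doubles (suc (suc zero)) = n≤1+n 4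

module _ {n : ℕ} (G : SimpleGraph n) (c : V (S G) → Fin 5) (hc : Is5PackingColoring (S G) c)
         (edges-colored-1 : ∀ e → c (inj₂ e) ≡ zero) where

  induced : Fin n → Fin 4
  induced x = merge-1-2 (c (inj₁ x))

  induced-class-0-packing : IsPacking (toGraph G) 1 (λ x → induced x ≡ zero)
  induced-class-0-packing x y fx fy x≢y d
    with adjacent⇒edge G (distLe-1⇒adjacent (toGraph G) d x≢y) | merge-1-2≡zero fx | merge-1-2≡zero fy
  ... | e , x∈e , _ | inj₁ cx | _ =
    hc zero (inj₁ x) (inj₂ e) cx (edges-colored-1 e) (λ ()) (1 , ≤-refl , step (ve x∈e) here)
  ... | e , _ , y∈e | _ | inj₁ cy =
    hc zero (inj₁ y) (inj₂ e) cy (edges-colored-1 e) (λ ()) (1 , ≤-refl , step (ve y∈e) here)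
  ... | _ | inj₂ cx | inj₂ cy =
    packing-restrict G ≤-refl (hc (suc zero)) x y cx cy x≢y d

  induced-coloring : IsSColoring (toGraph G) s1122 induced
  induced-coloring zero    = induced-class-0-packing
  induced-coloring (suc j) x y fx fy =
    packing-restrict G (radius-doubles j) (hc (suc (suc j))) x y (merge-1-2≡suc fx) (merge-1-2≡suc fy)

mainTheorem7 : (n : ℕ) (G : SimpleGraph n) →
    ¬ SColorable (toGraph G) s1122 →
    SColorable (S G) s12345 →
    (c : V (S G) → Fin 5) → Is5PackingColoring (S G) c →
    ∃ λ (e : EdgeOf G) → c (inj₂ e) ≢ zero
mainTheorem7 n G not-1122 _ c hc with any?-EdgeOf G (λ e → ¬? (c (inj₂ e) ≟ zero))
... | yes found = found
... | no none   = ⊥-elim (not-1122 (induced G c hc edges-colored-1 , induced-coloring G c hc edges-colored-1))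
  where
  edges-colored-1 : ∀ e → c (inj₂ e) ≡ zero
  edges-colored-1 e = decidable-stable (c (inj₂ e) ≟ zero) λ c≢0 → none (e , c≢0)
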